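{- Let $k\geq 3$ be odd. Suppose $K$ is a complete graph with edge coloring $f:E(K)\to\mathbb{Z}_k$, and there exists a partition of $V(K)$ into sets $V_1,\ldots,V_m$ such that $|V_i|\geq 2$ for each $i$, each clique $K[V_i]$ is monochromatic in some color $c_i\in\mathbb{Z}_k$, and every edge between $V_i$ and $V_j$ ($i\neq j$) has color $\overline{2}^{ -1}(c_i+c_j)$. Then for every subgraph $G$ of $K$, $$\sum_{e\in E(G)}f(e)=\overline{2}^{ -1}\sum_{i=1}^{m}c_i\sum_{v\in V(G)\cap V_i}\deg_G(v).$$
   Context: $\overline{2}^{ -1}$ denotes the multiplicative inverse of $2$ in $\mathbb{Z}_k$ (which exists since $k$ is odd). -}

module Defs where

open import Data.Nat as ℕ using (ℕ; NonZero; _<ᵇ_)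
open import Data.Nat.DivMod using (_mod_)
open import Data.Fin using (Fin; toℕ)
open import Data.Fin.Properties using (_≟_)
open import Data.Bool using (Bool; true; false; _∧_)
open import Data.List using (List; foldr; map; filterᵇ; length; allFin; concatMap)
open import Relation.Nullary.Decidable using (⌊_⌋)
open import Relation.Binary.PropositionalEquality using (_≡_)

ℤ/ : (k : ℕ) → Set
ℤ/ k = Fin k

⟦_⟧ : ∀ {k} .{{_ : NonZero k}} → ℕ → ℤ/ k
⟦_⟧ {k} n = n mod k

_+ₖ_ : ∀ {k} .{{_ : NonZero k}} → ℤ/ k → ℤ/ k → ℤ/ k
a +ₖ b = ⟦ toℕ a ℕ.+ toℕ b ⟧

_*ₖ_ : ∀ {k} .{{_ : NonZero k}} → ℤ/ k → ℤ/ k → ℤ/ k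
a *ₖ b = ⟦ toℕ a ℕ.* toℕ b ⟧

sumₖ : ∀ {k} .{{_ : NonZero k}} → List (ℤ/ k) → ℤ/ k
sumₖ = foldr _+ₖ_ ⟦ 0 ⟧

sumℕ : List ℕ → ℕ
sumℕ = foldr ℕ._+_ 0

record Subgraph (n : ℕ) : Set where
  field
    V      : Fin n → Bool
    E      : Fin n → Fin n → Bool
    E-sym  : ∀ u v → E u v ≡ E v u
    E-irr  : ∀ v → E v v ≡ false
    E-V    : ∀ u v → E u v ≡ true → V u ≡ true
open Subgraph public

deg : ∀ {n} → Subgraph n → Fin n → ℕ
deg {n} G v = length (filterᵇ (E G v) (allFin n))

-- the edges of G, each listed once as a pair (u , w) with u < w
edgeColorSum : ∀ {n k} .{{_ : NonZero k}} →
  (Fin n → Fin n → ℤ/ k) → Subgraph n → ℤ/ k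
edgeColorSum {n} f G =
  sumₖ (concatMap (λ u → map (f u)
          (filterᵇ (λ w → (toℕ u <ᵇ toℕ w) ∧ E G u w) (allFin n)))
        (allFin n))

-- Σ_{v ∈ V(G) ∩ V_i} deg_G(v), where V_i = p⁻¹(i)
degSumIn : ∀ {n m} → Subgraph n → (Fin n → Fin m) → Fin m → ℕ
degSumIn {n} G p i =
  sumℕ (map (deg G) (filterᵇ (λ v → V G v ∧ ⌊ p v ≟ i ⌋) (allFin n)))

{-# OPTIONS --safe #-}
module Submission where

-- Since 2h = 1 in ℤ_k, an edge inside a class V_i has colour c_i = h(c_i + c_i); so every edge uw
-- has colour h(c(u) + c(w)), where c(v) is the colour of the class of v. Lifting colours to ℕ and
-- reducing mod k only at the end, the colour sum is h · Σ_{uw ∈ E(G)} (c(u) + c(w)). Each edge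
-- contributes c(v) once at each of its endpoints v, so this is h · Σ_v c(v) deg_G(v); grouping the
-- vertices by class (vertices outside V(G) have degree 0) gives the right-hand side.

open import Defs
open import Data.Bool using (Bool; true; false; _∧_)
open import Data.Fin using (Fin; toℕ; zero; suc)
open import Data.Fin.Properties using (_≟_; punchInᵢ≢i; toℕ-fromℕ<; fromℕ<-cong; toℕ-injective; toℕ<n)
open import Data.List using (List; []; _∷_; map; allFin; filterᵇ; length; tabulate; concat; concatMap)
open import Data.List.Properties using (map-cong; map-∘; map-tabulate; map-concatMap; concatMap-cong)
open import Data.Nat using (ℕ; NonZero; _≤_; _<_; _%_; _<ᵇ_; _<?_; _+_; _*_)
open import Data.Nat.DivMod using (m%n<n; m<n⇒m%n≡m; %-distribˡ-+; %-distribˡ-*)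
open import Data.Nat.ListAction.Properties using (sum-++)
open import Data.Nat.Properties
  using (+-*-semiring; *-commutativeSemigroup; +-identityʳ; *-identityˡ; *-zeroʳ; *-assoc; *-comm;
         *-distribˡ-+; *-distribʳ-+; <-cmp)
open import Data.Nat.Solver using (module +-*-Solver)
open import Data.Product using (∃; _×_)
open import Data.Vec.Functional using (removeAt)
open import Function using (_∘_; id)
open import Relation.Binary.Definitions using (tri<; tri≈; tri>)
open import Relation.Binary.PropositionalEquality
  using (_≡_; _≢_; refl; sym; trans; cong; cong₂; module ≡-Reasoning)
open import Relation.Nullary using (¬_; yes; no)
open import Relation.Nullary.Decidable using (⌊_⌋; isYes≗does; dec-true; dec-false)

open import Algebra.Properties.CommutativeSemigroup *-commutativeSemigroup using (x∙yz≈y∙xz)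
open import Algebra.Properties.Semiring.Sum +-*-semiring
  using (sum; sum-syntax; sum-remove; sum-cong-≗; ∑-distrib-+; ∑-comm; *-distribˡ-sum; sum-replicate-zero)

open ≡-Reasoning

private variable
  A B : Set
  m n : ℕ

-- does (m <? n) reduces to m <ᵇ n.
<ᵇ-true : ∀ {m n} → m < n → (m <ᵇ n) ≡ true
<ᵇ-true {m} {n} = dec-true (m <? n)

<ᵇ-false : ∀ {m n} → ¬ m < n → (m <ᵇ n) ≡ false
<ᵇ-false {m} {n} = dec-false (m <? n)

𝟙 : Bool → ℕ
𝟙 true  = 1
𝟙 false = 0

sumℕ-tabulate : (g : Fin n → ℕ) → sumℕ (tabulate g) ≡ ∑[ i < n ] g i
sumℕ-tabulate {ℕ.zero}  g = refl
sumℕ-tabulate {ℕ.suc n} g = cong (g zero +_) (sumℕ-tabulate (g ∘ suc))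

sumℕ-map-allFin : (g : Fin n → ℕ) → sumℕ (map g (allFin n)) ≡ ∑[ i < n ] g i
sumℕ-map-allFin {n} g = trans (cong sumℕ (map-tabulate id g)) (sumℕ-tabulate g)

sumℕ-map-filterᵇ : (P : A → Bool) (g : A → ℕ) (xs : List A) →
  sumℕ (map g (filterᵇ P xs)) ≡ sumℕ (map (λ x → 𝟙 (P x) * g x) xs)
sumℕ-map-filterᵇ P g []       = refl
sumℕ-map-filterᵇ P g (x ∷ xs) with P x
... | true  = cong₂ _+_ (sym (+-identityʳ (g x))) (sumℕ-map-filterᵇ P g xs)
... | false = sumℕ-map-filterᵇ P g xs

length-filterᵇ : (P : A → Bool) (xs : List A) →
  length (filterᵇ P xs) ≡ sumℕ (map (𝟙 ∘ P) xs)
length-filterᵇ P []       = refl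
length-filterᵇ P (x ∷ xs) with P x
... | true  = cong ℕ.suc (length-filterᵇ P xs)
... | false = length-filterᵇ P xs

sumℕ-concat : (xss : List (List ℕ)) → sumℕ (concat xss) ≡ sumℕ (map sumℕ xss)
sumℕ-concat []         = refl
sumℕ-concat (xs ∷ xss) = trans (sum-++ xs (concat xss)) (cong (sumℕ xs +_) (sumℕ-concat xss))

map-filterᵇ-cong : {P : A → Bool} {f g : A → B} → (∀ x → P x ≡ true → f x ≡ g x) →
  (xs : List A) → map f (filterᵇ P xs) ≡ map g (filterᵇ P xs)
map-filterᵇ-cong         f≡g []       = refl
map-filterᵇ-cong {P = P} f≡g (x ∷ xs) with P x in Px
... | true  = cong₂ _∷_ (f≡g x Px) (map-filterᵇ-cong f≡g xs)
... | false = map-filterᵇ-cong f≡g xs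

∑-single : (j : Fin n) (a : Fin n → ℕ) → (∀ i → i ≢ j → a i ≡ 0) → ∑[ i < n ] a i ≡ a j
∑-single {ℕ.suc n} j a a≡0 = begin
  ∑[ i < ℕ.suc n ] a i          ≡⟨ sum-remove a ⟩
  a j + sum (removeAt a j)      ≡⟨ cong (a j +_) (sum-cong-≗ {n} (λ i → a≡0 _ (punchInᵢ≢i j i))) ⟩
  a j + ∑[ _ < n ] 0             ≡⟨ cong (a j +_) (sum-replicate-zero n) ⟩
  a j + 0                       ≡⟨ +-identityʳ (a j) ⟩
  a j                           ∎

∑-select : (j : Fin n) (x : Fin n → ℕ) → ∑[ i < n ] (𝟙 ⌊ j ≟ i ⌋ * x i) ≡ x j
∑-select j x = begin
  ∑[ i < _ ] (𝟙 ⌊ j ≟ i ⌋ * x i)  ≡⟨ ∑-single j _ (λ i i≢j → cong (λ b → 𝟙 b * x i) (isYes-false (i≢j ∘ sym))) ⟩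
  𝟙 ⌊ j ≟ j ⌋ * x j               ≡⟨ cong (λ b → 𝟙 b * x j) (isYes-true refl) ⟩
  1 * x j                         ≡⟨ *-identityˡ (x j) ⟩
  x j                             ∎
  where
  isYes-true : ∀ {i} → j ≡ i → ⌊ j ≟ i ⌋ ≡ true
  isYes-true {i} j≡i = trans (isYes≗does (j ≟ i)) (dec-true (j ≟ i) j≡i)
  isYes-false : ∀ {i} → j ≢ i → ⌊ j ≟ i ⌋ ≡ false
  isYes-false {i} j≢i = trans (isYes≗does (j ≟ i)) (dec-false (j ≟ i) j≢i)

∑-fibres : (p : Fin n → Fin m) (g : Fin m → ℕ) (a : Fin n → ℕ) →
  ∑[ i < m ] (g i * ∑[ v < n ] (𝟙 ⌊ p v ≟ i ⌋ * a v)) ≡ ∑[ v < n ] (g (p v) * a v)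
∑-fibres {n} {m} p g a = begin
  ∑[ i < m ] (g i * ∑[ v < n ] (𝟙 ⌊ p v ≟ i ⌋ * a v))
    ≡⟨ sum-cong-≗ (λ i → *-distribˡ-sum (g i) (λ v → 𝟙 ⌊ p v ≟ i ⌋ * a v)) ⟩
  ∑[ i < m ] ∑[ v < n ] (g i * (𝟙 ⌊ p v ≟ i ⌋ * a v))
    ≡⟨ ∑-comm (λ i v → g i * (𝟙 ⌊ p v ≟ i ⌋ * a v)) ⟩
  ∑[ v < n ] ∑[ i < m ] (g i * (𝟙 ⌊ p v ≟ i ⌋ * a v))
    ≡⟨ sum-cong-≗ (λ v → sum-cong-≗ (λ i → x∙yz≈y∙xz (g i) (𝟙 ⌊ p v ≟ i ⌋) (a v))) ⟩
  ∑[ v < n ] ∑[ i < m ] (𝟙 ⌊ p v ≟ i ⌋ * (g i * a v))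
    ≡⟨ sum-cong-≗ (λ v → ∑-select (p v) (λ i → g i * a v)) ⟩
  ∑[ v < n ] (g (p v) * a v) ∎

∑∑-distrib-+ : (x y : Fin n → Fin m → ℕ) →
  ∑[ u < n ] ∑[ w < m ] (x u w + y u w) ≡ ∑[ u < n ] ∑[ w < m ] x u w + ∑[ u < n ] ∑[ w < m ] y u w
∑∑-distrib-+ {m = m} x y = trans (sum-cong-≗ (λ u → ∑-distrib-+ (x u) (y u)))
  (∑-distrib-+ (λ u → ∑[ w < m ] x u w) (λ u → ∑[ w < m ] y u w))

E< : Subgraph n → Fin n → Fin n → Bool
E< G u w = (toℕ u <ᵇ toℕ w) ∧ E G u w

-- edgeColorSum f G unfolds to sumₖ (mapEdges f G).
mapEdges : (Fin n → Fin n → A) → Subgraph n → List A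
mapEdges {n} f G = concatMap (λ u → map (f u) (filterᵇ (E< G u) (allFin n))) (allFin n)

module _ (G : Subgraph n) where

  E<⇒E : ∀ {u w} → E< G u w ≡ true → E G u w ≡ true
  E<⇒E {u} {w} uw with toℕ u <ᵇ toℕ w
  ... | true = uw

  E⇒≢ : ∀ {u w} → E G u w ≡ true → u ≢ w
  E⇒≢ {u} uw refl with () ← trans (sym uw) (E-irr G u)

  𝟙-E<-orient : ∀ u w → 𝟙 (E< G u w) + 𝟙 (E< G w u) ≡ 𝟙 (E G u w)
  𝟙-E<-orient u w with <-cmp (toℕ u) (toℕ w)
  ... | tri< u<w _ u≯w rewrite <ᵇ-true u<w | <ᵇ-false u≯w = +-identityʳ _
  ... | tri> u≮w _ u>w rewrite <ᵇ-false u≮w | <ᵇ-true u>w = cong 𝟙 (E-sym G w u)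
  ... | tri≈ u≮w u≡w _ with refl ← toℕ-injective u≡w rewrite <ᵇ-false u≮w | E-irr G u = refl

  deg-∑ : ∀ v → deg G v ≡ ∑[ w < n ] 𝟙 (E G v w)
  deg-∑ v = trans (length-filterᵇ (E G v) (allFin n)) (sumℕ-map-allFin (𝟙 ∘ E G v))

  deg-outside : ∀ {v} → V G v ≡ false → deg G v ≡ 0
  deg-outside {v} v∉G = trans (deg-∑ v) (trans (sum-cong-≗ no-edge) (sum-replicate-zero n))
    where
    no-edge : ∀ w → 𝟙 (E G v w) ≡ 0
    no-edge w with E G v w in vw
    ... | true with () ← trans (sym v∉G) (E-V G v w vw)
    ... | false = refl

  handshake : (a : Fin n → ℕ) →
    ∑[ u < n ] ∑[ w < n ] (𝟙 (E< G u w) * (a u + a w)) ≡ ∑[ v < n ] (a v * deg G v)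
  handshake a = begin
    ∑[ u < n ] ∑[ w < n ] (𝟙 (E< G u w) * (a u + a w))
      ≡⟨ sum-cong-≗ (λ u → sum-cong-≗ (λ w → *-distribˡ-+ (𝟙 (E< G u w)) (a u) (a w))) ⟩
    ∑[ u < n ] ∑[ w < n ] (𝟙 (E< G u w) * a u + 𝟙 (E< G u w) * a w)
      ≡⟨ ∑∑-distrib-+ (λ u w → 𝟙 (E< G u w) * a u) (λ u w → 𝟙 (E< G u w) * a w) ⟩
    ∑[ u < n ] ∑[ w < n ] (𝟙 (E< G u w) * a u) + ∑[ u < n ] ∑[ w < n ] (𝟙 (E< G u w) * a w)
      ≡⟨ cong (∑[ u < n ] ∑[ w < n ] (𝟙 (E< G u w) * a u) +_) (∑-comm (λ u w → 𝟙 (E< G u w) * a w)) ⟩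
    ∑[ u < n ] ∑[ w < n ] (𝟙 (E< G u w) * a u) + ∑[ u < n ] ∑[ w < n ] (𝟙 (E< G w u) * a u)
      ≡⟨ ∑∑-distrib-+ (λ u w → 𝟙 (E< G u w) * a u) (λ u w → 𝟙 (E< G w u) * a u) ⟨
    ∑[ u < n ] ∑[ w < n ] (𝟙 (E< G u w) * a u + 𝟙 (E< G w u) * a u)
      ≡⟨ sum-cong-≗ (λ u → sum-cong-≗ (λ w → orient u w)) ⟩
    ∑[ u < n ] ∑[ w < n ] (𝟙 (E G u w) * a u)
      ≡⟨ sum-cong-≗ neighbours ⟩
    ∑[ v < n ] (a v * deg G v) ∎
    where
    orient : ∀ u w → 𝟙 (E< G u w) * a u + 𝟙 (E< G w u) * a u ≡ 𝟙 (E G u w) * a u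
    orient u w = trans (sym (*-distribʳ-+ (a u) (𝟙 (E< G u w)) (𝟙 (E< G w u))))
      (cong (_* a u) (𝟙-E<-orient u w))
    neighbours : ∀ v → ∑[ w < n ] (𝟙 (E G v w) * a v) ≡ a v * deg G v
    neighbours v = begin
      ∑[ w < n ] (𝟙 (E G v w) * a v) ≡⟨ sum-cong-≗ (λ w → *-comm (𝟙 (E G v w)) (a v)) ⟩
      ∑[ w < n ] (a v * 𝟙 (E G v w)) ≡⟨ *-distribˡ-sum (a v) (𝟙 ∘ E G v) ⟨
      a v * ∑[ w < n ] 𝟙 (E G v w)   ≡⟨ cong (a v *_) (deg-∑ v) ⟨
      a v * deg G v                  ∎

  degSumIn-∑ : (p : Fin n → Fin m) (i : Fin m) →
    degSumIn G p i ≡ ∑[ v < n ] (𝟙 ⌊ p v ≟ i ⌋ * deg G v)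
  degSumIn-∑ p i = begin
    degSumIn G p i
      ≡⟨ sumℕ-map-filterᵇ (λ v → V G v ∧ ⌊ p v ≟ i ⌋) (deg G) (allFin n) ⟩
    sumℕ (map (λ v → 𝟙 (V G v ∧ ⌊ p v ≟ i ⌋) * deg G v) (allFin n))
      ≡⟨ sumℕ-map-allFin (λ v → 𝟙 (V G v ∧ ⌊ p v ≟ i ⌋) * deg G v) ⟩
    ∑[ v < n ] (𝟙 (V G v ∧ ⌊ p v ≟ i ⌋) * deg G v)
      ≡⟨ sum-cong-≗ (λ v → drop-V v ⌊ p v ≟ i ⌋) ⟩
    ∑[ v < n ] (𝟙 ⌊ p v ≟ i ⌋ * deg G v) ∎
    where
    drop-V : ∀ v b → 𝟙 (V G v ∧ b) * deg G v ≡ 𝟙 b * deg G v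
    drop-V v b with V G v in v∈G
    ... | true  = refl
    ... | false = sym (trans (cong (𝟙 b *_) (deg-outside v∈G)) (*-zeroʳ (𝟙 b)))

  mapEdges-cong : {f g : Fin n → Fin n → A} → (∀ u w → E G u w ≡ true → f u w ≡ g u w) →
    mapEdges f G ≡ mapEdges g G
  mapEdges-cong f≡g =
    concatMap-cong (λ u → map-filterᵇ-cong (λ w uw → f≡g u w (E<⇒E uw)) (allFin n)) (allFin n)

  mapEdges-map : (h : A → B) (f : Fin n → Fin n → A) →
    mapEdges (λ u w → h (f u w)) G ≡ map h (mapEdges f G)
  mapEdges-map h f = trans (concatMap-cong (λ u → map-∘ (filterᵇ (E< G u) (allFin n))) (allFin n))
    (sym (map-concatMap h (λ u → map (f u) (filterᵇ (E< G u) (allFin n))) (allFin n)))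

  sumℕ-mapEdges : (g : Fin n → Fin n → ℕ) →
    sumℕ (mapEdges g G) ≡ ∑[ u < n ] ∑[ w < n ] (𝟙 (E< G u w) * g u w)
  sumℕ-mapEdges g = begin
    sumℕ (concat (map edgesFrom (allFin n)))   ≡⟨ sumℕ-concat (map edgesFrom (allFin n)) ⟩
    sumℕ (map sumℕ (map edgesFrom (allFin n))) ≡⟨ cong sumℕ (map-∘ (allFin n)) ⟨
    sumℕ (map (sumℕ ∘ edgesFrom) (allFin n))   ≡⟨ sumℕ-map-allFin (sumℕ ∘ edgesFrom) ⟩
    ∑[ u < n ] sumℕ (edgesFrom u)              ≡⟨ sum-cong-≗ edgesFrom-∑ ⟩
    ∑[ u < n ] ∑[ w < n ] (𝟙 (E< G u w) * g u w) ∎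
    where
    edgesFrom : Fin n → List ℕ
    edgesFrom u = map (g u) (filterᵇ (E< G u) (allFin n))
    edgesFrom-∑ : ∀ u → sumℕ (edgesFrom u) ≡ ∑[ w < n ] (𝟙 (E< G u w) * g u w)
    edgesFrom-∑ u = trans (sumℕ-map-filterᵇ (E< G u) (g u) (allFin n))
      (sumℕ-map-allFin (λ w → 𝟙 (E< G u w) * g u w))

  ∑-edges-class-weights : (p : Fin n → Fin m) (b : Fin m → ℕ) →
    ∑[ u < n ] ∑[ w < n ] (𝟙 (E< G u w) * (b (p u) + b (p w))) ≡ ∑[ i < m ] (b i * degSumIn G p i)
  ∑-edges-class-weights {m} p b = begin
    ∑[ u < n ] ∑[ w < n ] (𝟙 (E< G u w) * (b (p u) + b (p w)))
      ≡⟨ handshake (b ∘ p) ⟩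
    ∑[ v < n ] (b (p v) * deg G v)
      ≡⟨ ∑-fibres p b (deg G) ⟨
    ∑[ i < m ] (b i * ∑[ v < n ] (𝟙 ⌊ p v ≟ i ⌋ * deg G v))
      ≡⟨ sum-cong-≗ (λ i → cong (b i *_) (degSumIn-∑ p i)) ⟨
    ∑[ i < m ] (b i * degSumIn G p i) ∎

module _ {k : ℕ} .{{_ : NonZero k}} where

  toℕ-⟦⟧ : ∀ a → toℕ (⟦_⟧ {k} a) ≡ a % k
  toℕ-⟦⟧ a = toℕ-fromℕ< (m%n<n a k)

  ⟦⟧-cong-% : ∀ {a b} → a % k ≡ b % k → ⟦_⟧ {k} a ≡ ⟦ b ⟧
  ⟦⟧-cong-% {a} {b} eq = fromℕ<-cong (a % k) (b % k) eq (m%n<n a k) (m%n<n b k)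

  ⟦⟧-toℕ : (x : ℤ/ k) → ⟦ toℕ x ⟧ ≡ x
  ⟦⟧-toℕ x = toℕ-injective (trans (toℕ-⟦⟧ (toℕ x)) (m<n⇒m%n≡m (toℕ<n x)))

  ⟦⟧-homo-+ : ∀ a b → ⟦_⟧ {k} (a + b) ≡ ⟦ a ⟧ +ₖ ⟦ b ⟧
  ⟦⟧-homo-+ a b = ⟦⟧-cong-% (trans (%-distribˡ-+ a b k)
    (sym (cong₂ (λ x y → (x + y) % k) (toℕ-⟦⟧ a) (toℕ-⟦⟧ b))))

  ⟦⟧-homo-* : ∀ a b → ⟦_⟧ {k} (a * b) ≡ ⟦ a ⟧ *ₖ ⟦ b ⟧
  ⟦⟧-homo-* a b = ⟦⟧-cong-% (trans (%-distribˡ-* a b k)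
    (sym (cong₂ (λ x y → (x * y) % k) (toℕ-⟦⟧ a) (toℕ-⟦⟧ b))))

  ⟦⟧-homo-sumℕ : (ns : List ℕ) → ⟦_⟧ {k} (sumℕ ns) ≡ sumₖ (map ⟦_⟧ ns)
  ⟦⟧-homo-sumℕ []       = refl
  ⟦⟧-homo-sumℕ (a ∷ ns) = trans (⟦⟧-homo-+ a (sumℕ ns)) (cong (⟦ a ⟧ +ₖ_) (⟦⟧-homo-sumℕ ns))

  ⟦⟧-homo-∑ : (a : Fin m → ℕ) → ⟦_⟧ {k} (∑[ i < m ] a i) ≡ sumₖ (map (⟦_⟧ ∘ a) (allFin m))
  ⟦⟧-homo-∑ {m} a = begin
    ⟦ ∑[ i < m ] a i ⟧                ≡⟨ cong ⟦_⟧ (sumℕ-map-allFin a) ⟨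
    ⟦ sumℕ (map a (allFin m)) ⟧       ≡⟨ ⟦⟧-homo-sumℕ (map a (allFin m)) ⟩
    sumₖ (map ⟦_⟧ (map a (allFin m))) ≡⟨ cong sumₖ (map-∘ (allFin m)) ⟨
    sumₖ (map (⟦_⟧ ∘ a) (allFin m))   ∎

  ⟦⟧-*-+ : (h x y : ℤ/ k) → h *ₖ (x +ₖ y) ≡ ⟦ toℕ h * toℕ x + toℕ h * toℕ y ⟧
  ⟦⟧-*-+ h x y = begin
    h *ₖ (x +ₖ y)                           ≡⟨ cong₂ (λ a b → a *ₖ (b +ₖ y)) (⟦⟧-toℕ h) (⟦⟧-toℕ x) ⟨
    ⟦ H ⟧ *ₖ (⟦ X ⟧ +ₖ y)                   ≡⟨ cong (λ b → ⟦ H ⟧ *ₖ (⟦ X ⟧ +ₖ b)) (⟦⟧-toℕ y) ⟨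
    ⟦ H ⟧ *ₖ (⟦ X ⟧ +ₖ ⟦ Y ⟧)               ≡⟨ cong (⟦ H ⟧ *ₖ_) (⟦⟧-homo-+ X Y) ⟨
    ⟦ H ⟧ *ₖ ⟦ X + Y ⟧                      ≡⟨ ⟦⟧-homo-* H (X + Y) ⟨
    ⟦ H * (X + Y) ⟧                         ≡⟨ cong ⟦_⟧ (*-distribˡ-+ H X Y) ⟩
    ⟦ H * X + H * Y ⟧                       ∎
    where H = toℕ h; X = toℕ x; Y = toℕ y

  half-of-double : (h : ℤ/ k) → h *ₖ ⟦ 2 ⟧ ≡ ⟦ 1 ⟧ → (x : ℤ/ k) → h *ₖ (x +ₖ x) ≡ x
  half-of-double h h*2≡1 x = begin
    h *ₖ (x +ₖ x)            ≡⟨ ⟦⟧-*-+ h x x ⟩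
    ⟦ H * X + H * X ⟧        ≡⟨ cong ⟦_⟧ (solve 2 (λ H X → H :* X :+ H :* X := (H :* con 2) :* X) refl H X) ⟩
    ⟦ (H * 2) * X ⟧          ≡⟨ ⟦⟧-homo-* (H * 2) X ⟩
    ⟦ H * 2 ⟧ *ₖ ⟦ X ⟧       ≡⟨ cong₂ _*ₖ_ (trans (⟦⟧-homo-* H 2) (cong (_*ₖ ⟦ 2 ⟧) (⟦⟧-toℕ h))) (⟦⟧-toℕ x) ⟩
    (h *ₖ ⟦ 2 ⟧) *ₖ x        ≡⟨ cong (_*ₖ x) h*2≡1 ⟩
    ⟦ 1 ⟧ *ₖ x               ≡⟨ cong (⟦ 1 ⟧ *ₖ_) (⟦⟧-toℕ x) ⟨
    ⟦ 1 ⟧ *ₖ ⟦ X ⟧           ≡⟨ ⟦⟧-homo-* 1 X ⟨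
    ⟦ 1 * X ⟧                ≡⟨ cong ⟦_⟧ (*-identityˡ X) ⟩
    ⟦ X ⟧                    ≡⟨ ⟦⟧-toℕ x ⟩
    x                        ∎
    where
    open +-*-Solver using (solve; _:+_; _:*_; _:=_; con)
    H = toℕ h
    X = toℕ x

  edgeColorSum-cong : (G : Subgraph n) {f g : Fin n → Fin n → ℤ/ k} →
    (∀ u w → E G u w ≡ true → f u w ≡ g u w) → edgeColorSum f G ≡ edgeColorSum g G
  edgeColorSum-cong G f≡g = cong sumₖ (mapEdges-cong G f≡g)

  edgeColorSum-⟦⟧ : (G : Subgraph n) (g : Fin n → Fin n → ℕ) →
    edgeColorSum (λ u w → ⟦ g u w ⟧) G ≡ ⟦ ∑[ u < n ] ∑[ w < n ] (𝟙 (E< G u w) * g u w) ⟧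
  edgeColorSum-⟦⟧ G g = begin
    sumₖ (mapEdges (λ u w → ⟦ g u w ⟧) G) ≡⟨ cong sumₖ (mapEdges-map G ⟦_⟧ g) ⟩
    sumₖ (map ⟦_⟧ (mapEdges g G))         ≡⟨ ⟦⟧-homo-sumℕ (mapEdges g G) ⟨
    ⟦ sumℕ (mapEdges g G) ⟧               ≡⟨ cong ⟦_⟧ (sumℕ-mapEdges G g) ⟩
    ⟦ ∑[ u < _ ] ∑[ w < _ ] (𝟙 (E< G u w) * g u w) ⟧ ∎

  ⟦⟧-scaled-∑ : (x : ℤ/ k) (y : Fin m → ℤ/ k) (d : Fin m → ℕ) →
    ⟦ ∑[ i < m ] (toℕ x * toℕ (y i) * d i) ⟧ ≡ x *ₖ sumₖ (map (λ i → y i *ₖ ⟦ d i ⟧) (allFin m))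
  ⟦⟧-scaled-∑ {m} x y d = begin
    ⟦ ∑[ i < m ] (X * toℕ (y i) * d i) ⟧
      ≡⟨ cong ⟦_⟧ (trans (sum-cong-≗ (λ i → *-assoc X (toℕ (y i)) (d i))) (sym (*-distribˡ-sum X yd))) ⟩
    ⟦ X * ∑[ i < m ] yd i ⟧
      ≡⟨ ⟦⟧-homo-* X (∑[ i < m ] yd i) ⟩
    ⟦ X ⟧ *ₖ ⟦ ∑[ i < m ] yd i ⟧
      ≡⟨ cong₂ _*ₖ_ (⟦⟧-toℕ x) (⟦⟧-homo-∑ yd) ⟩
    x *ₖ sumₖ (map (⟦_⟧ ∘ yd) (allFin m))
      ≡⟨ cong (λ s → x *ₖ sumₖ s) (map-cong ⟦yd⟧ (allFin m)) ⟩
    x *ₖ sumₖ (map (λ i → y i *ₖ ⟦ d i ⟧) (allFin m)) ∎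
    where
    X = toℕ x
    yd : Fin m → ℕ
    yd i = toℕ (y i) * d i
    ⟦yd⟧ : ∀ i → ⟦ yd i ⟧ ≡ y i *ₖ ⟦ d i ⟧
    ⟦yd⟧ i = trans (⟦⟧-homo-* (toℕ (y i)) (d i)) (cong (_*ₖ ⟦ d i ⟧) (⟦⟧-toℕ (y i)))

  uniform-colour : (h : ℤ/ k) → h *ₖ ⟦ 2 ⟧ ≡ ⟦ 1 ⟧ →
    (f : Fin n → Fin n → ℤ/ k) (p : Fin n → Fin m) (c : Fin m → ℤ/ k) →
    (∀ u v → u ≢ v → p u ≡ p v → f u v ≡ c (p u)) →
    (∀ u v → p u ≢ p v → f u v ≡ h *ₖ (c (p u) +ₖ c (p v))) →
    ∀ u v → u ≢ v → f u v ≡ h *ₖ (c (p u) +ₖ c (p v))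
  uniform-colour h h*2≡1 f p c same diff u v u≢v with p u ≟ p v
  ... | no  pu≢pv = diff u v pu≢pv
  ... | yes pu≡pv = begin
    f u v                     ≡⟨ same u v u≢v pu≡pv ⟩
    c (p u)                   ≡⟨ half-of-double h h*2≡1 (c (p u)) ⟨
    h *ₖ (c (p u) +ₖ c (p u)) ≡⟨ cong (λ i → h *ₖ (c (p u) +ₖ c i)) pu≡pv ⟩
    h *ₖ (c (p u) +ₖ c (p v)) ∎

lemma2p6 : (k : ℕ) .{{_ : NonZero k}} → 3 ≤ k → k % 2 ≡ 1 →
    (h : ℤ/ k) → h *ₖ ⟦ 2 ⟧ ≡ ⟦ 1 ⟧ →
    (n m : ℕ) (f : Fin n → Fin n → ℤ/ k) → (∀ u v → f u v ≡ f v u) →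
    (p : Fin n → Fin m) (c : Fin m → ℤ/ k) →
    (∀ i → ∃ λ u → ∃ λ v → ¬ u ≡ v × p u ≡ i × p v ≡ i) →
    (∀ u v → ¬ u ≡ v → p u ≡ p v → f u v ≡ c (p u)) →
    (∀ u v → ¬ p u ≡ p v → f u v ≡ h *ₖ (c (p u) +ₖ c (p v))) →
    (G : Subgraph n) →
    edgeColorSum f G ≡ h *ₖ sumₖ (map (λ i → c i *ₖ ⟦ degSumIn G p i ⟧) (allFin m))
-- Oddness of k only serves to make h exist, and h is given.
lemma2p6 k _ _ h h*2≡1 n m f _ p c _ same diff G = begin
  edgeColorSum f G
    ≡⟨ edgeColorSum-cong G edge-colour ⟩
  edgeColorSum (λ u w → ⟦ b (p u) + b (p w) ⟧) G
    ≡⟨ edgeColorSum-⟦⟧ G (λ u w → b (p u) + b (p w)) ⟩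
  ⟦ ∑[ u < n ] ∑[ w < n ] (𝟙 (E< G u w) * (b (p u) + b (p w))) ⟧
    ≡⟨ cong ⟦_⟧ (∑-edges-class-weights G p b) ⟩
  ⟦ ∑[ i < m ] (b i * degSumIn G p i) ⟧
    ≡⟨ ⟦⟧-scaled-∑ h c (degSumIn G p) ⟩
  h *ₖ sumₖ (map (λ i → c i *ₖ ⟦ degSumIn G p i ⟧) (allFin m)) ∎
  where
  b : Fin m → ℕ
  b i = toℕ h * toℕ (c i)
  edge-colour : ∀ u w → E G u w ≡ true → f u w ≡ ⟦ b (p u) + b (p w) ⟧
  edge-colour u w uw =
    trans (uniform-colour h h*2≡1 f p c same diff u w (E⇒≢ G uw)) (⟦⟧-*-+ h (c (p u)) (c (p w)))
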